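{- Let $\ell\ge 0$ and $n=\frac{\ell(\ell+1)}{2}$. Then for every integer $k$ with $0\le k\le \ell-2$, \[ a_{2,2k+1}(n)-a_{2,2k+3}(n)=1. \]
   Context: A partition of $n$ is a non-increasing sequence of positive integers summing to $n$; its Young diagram is the left-justified array of boxes whose $i$-th row has $\lambda_i$ boxes. The hook length of a box is the number of boxes directly to its right, plus the number directly below it, plus $1$; a box of hook length $k$ is a $k$-hook. For $t\ge 2$, a $t$-core partition is a partition none of whose hook lengths is divisible by $t$. $a_{t,k}(n)$ denotes the total number of hooks of length $k$ summed over all $t$-core partitions of $n$. -}

module Defs where

open import Data.Nat using (ℕ; zero; suc; _+_; _*_; _∸_; _<ᵇ_; _≡ᵇ_; _⊓_)
open import Data.Nat.Divisibility using (_∣?_)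
open import Data.Bool using (Bool; true; false; not; if_then_else_)
open import Data.List using (List; []; _∷_; map; concatMap; upTo; filterᵇ; length)
open import Data.Nat.ListAction using (sum)
open import Data.Bool.ListAction using (and)
open import Relation.Nullary using (does)

-- A partition is represented as the list of its row lengths (λ₁, λ₂, …),
-- non-increasing, positive parts.

-- partitionsBounded f n m : all partitions of n with every part ≤ m
-- (f is fuel; f = n suffices since each step removes a part ≥ 1).
partitionsBounded : ℕ → ℕ → ℕ → List (List ℕ)
partitionsBounded _       zero    _ = [] ∷ []
partitionsBounded zero    (suc _) _ = []
partitionsBounded (suc f) (suc n) m =
  concatMap (λ i → let p = suc i in
               map (p ∷_) (partitionsBounded f (suc n ∸ p) p))
            (upTo (m ⊓ suc n))

partitions : ℕ → List (List ℕ)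
partitions n = partitionsBounded n n n

-- Conjugate column length: λ'_j = number of rows i with λ_i > j (0-indexed j).
colLength : List ℕ → ℕ → ℕ
colLength λs j = length (filterᵇ (λ r → j <ᵇ r) λs)

-- Hook lengths of all boxes of rows starting at row index i (0-indexed),
-- for the full partition λs. Box (i,j), j < λ_i, has hook length
-- (λ_i - j - 1) [arm] + (λ'_j - i - 1) [leg] + 1.
hooksFrom : List ℕ → ℕ → List ℕ → List ℕ
hooksFrom λs i []       = []
hooksFrom λs i (r ∷ rs) =
  map (λ j → (r ∸ j ∸ 1) + (colLength λs j ∸ i ∸ 1) + 1) (upTo r)
  Data.List.++ hooksFrom λs (suc i) rs

hookLengths : List ℕ → List ℕ
hookLengths λs = hooksFrom λs 0 λs

isCore : ℕ → List ℕ → Bool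
isCore t λs = and (map (λ h → not (does (t ∣? h))) (hookLengths λs))

numHooks : ℕ → List ℕ → ℕ
numHooks k λs = length (filterᵇ (λ h → h ≡ᵇ k) (hookLengths λs))

a : ℕ → ℕ → ℕ → ℕ
a t k n = sum (map (numHooks k) (filterᵇ (isCore t) (partitions n)))

{-# OPTIONS --safe #-}
-- The 2-cores are exactly the staircases δₘ = (m, m − 1, …, 1). Removing the first row of a 2-core
-- leaves a 2-core, by induction a staircase δₘ, and the removed row r must be m + 1: for r = m the
-- last box of the first row has hook length 2, and for r ≥ m + 2 so does the box two before its end.
-- Since |δₘ| = m(m + 1)/2 is injective in m, δ_ℓ is the only 2-core of ℓ(ℓ + 1)/2. The first row of
-- δₘ₊₁ has hook lengths 2m + 1, 2m − 1, …, 1, so δ_ℓ has exactly ℓ − k hooks of length 2k + 1.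
module Submission where

open import Defs
open import Data.Nat using (ℕ; zero; suc; pred; _+_; _*_; _∸_; _≤_; _<_; _⊓_; _≡ᵇ_; _<ᵇ_; z≤n; s≤s; z<s)
open import Data.Nat.Properties
open import Data.Nat.DivMod using (_/_; m*n/n≡m)
open import Data.Nat.Divisibility using (_∣_; _∤_; _∣?_; ∣-refl; ∣m+n∣m⇒∣n; m∣m*n; ∣1⇒≡1)
open import Data.Nat.ListAction using (sum)
open import Data.Nat.Solver using (module +-*-Solver)
open import Data.Bool using (T; T?; not)
open import Data.List using (List; []; _∷_; _++_; map; concat; concatMap; applyUpTo; upTo; filter; filterᵇ; length)
open import Data.List.Properties
  using ( ≡-dec; ∷-injectiveˡ; ∷-injectiveʳ; ++-identityʳ; length-++; map-cong; map-cong-local; map-applyUpTo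
        ; filter-++; filter-accept; filter-reject; filter-none)
open import Data.List.Relation.Unary.All as All using (All; []; _∷_)
open import Data.List.Relation.Unary.All.Properties
  using (++⁺; ++⁻; map⁺; map⁻; concat⁺; applyUpTo⁺₁; applyUpTo⁻; all-upTo; all⁺; all⁻)
open import Data.Product using (_×_; _,_; proj₁; proj₂)
open import Data.Empty using (⊥-elim)
open import Data.Sum using (inj₁; inj₂)
open import Function using (_∘_; _⇔_; mk⇔; Injective)
open import Function.Bundles using (module Equivalence)
open import Relation.Binary using (DecidableEquality; tri<; tri≈; tri>)
open import Relation.Binary.PropositionalEquality
  using (_≡_; _≢_; ≢-sym; refl; sym; trans; cong; cong₂; subst; module ≡-Reasoning)
open import Relation.Nullary using (Dec; does; yes; no; ¬_)
open import Relation.Unary using (Decidable)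

open ≡-Reasoning

module _ {A : Set} where

  module _ {P Q : A → Set} (P? : Decidable P) (Q? : Decidable Q) where

    filter-cong-local : ∀ {xs} → All (λ x → P x ⇔ Q x) xs → filter P? xs ≡ filter Q? xs
    filter-cong-local {[]}     []           = refl
    filter-cong-local {x ∷ xs} (P⇔Q ∷ P⇔Qs) with P? x
    ... | yes px = trans (cong (x ∷_) (filter-cong-local P⇔Qs)) (sym (filter-accept Q? (Equivalence.to P⇔Q px)))
    ... | no ¬px = trans (filter-cong-local P⇔Qs) (sym (filter-reject Q? (¬px ∘ Equivalence.from P⇔Q)))

  module _ {B : Set} {P : A → Set} (P? : Decidable P) where

    filter-concatMap : ∀ (f : B → List A) xs → filter P? (concatMap f xs) ≡ concatMap (filter P? ∘ f) xs
    filter-concatMap f []       = refl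
    filter-concatMap f (x ∷ xs) =
      trans (filter-++ P? (f x) (concatMap f xs)) (cong (filter P? (f x) ++_) (filter-concatMap f xs))

  concat-applyUpTo-empty : ∀ (g : ℕ → List A) n → (∀ {j} → j < n → g j ≡ []) → concat (applyUpTo g n) ≡ []
  concat-applyUpTo-empty g zero    _     = refl
  concat-applyUpTo-empty g (suc n) empty rewrite empty z<s = concat-applyUpTo-empty (g ∘ suc) n (empty ∘ s≤s)

  concat-applyUpTo-single : ∀ (g : ℕ → List A) n {i} → i < n → (∀ {j} → j < n → j ≢ i → g j ≡ []) →
                            concat (applyUpTo g n) ≡ g i
  concat-applyUpTo-single g (suc n) {zero} _ empty =
    trans (cong (g 0 ++_) (concat-applyUpTo-empty (g ∘ suc) n (λ j<n → empty (s≤s j<n) λ ())))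
          (++-identityʳ (g 0))
  concat-applyUpTo-single g (suc n) {suc i} (s≤s i<n) empty rewrite empty z<s (λ ()) =
    concat-applyUpTo-single (g ∘ suc) n i<n (λ j<n j≢i → empty (s≤s j<n) (j≢i ∘ suc-injective))

  concatMap-upTo-single : ∀ (g : ℕ → List A) n {i} → i < n → (∀ {j} → j < n → j ≢ i → g j ≡ []) →
                          concatMap g (upTo n) ≡ g i
  concatMap-upTo-single g n i<n empty =
    trans (cong concat (map-applyUpTo (λ j → j) g n)) (concat-applyUpTo-single g n i<n empty)

  module _ {B : Set} (_≟ᴬ_ : DecidableEquality A) (_≟ᴮ_ : DecidableEquality B) {f : A → B} where

    filter-≟-map-injective : Injective _≡_ _≡_ f → ∀ q xs →
                             filter (_≟ᴮ f q) (map f xs) ≡ map f (filter (_≟ᴬ q) xs)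
    filter-≟-map-injective f-inj q []       = refl
    filter-≟-map-injective f-inj q (x ∷ xs) with x ≟ᴬ q
    ... | yes refl = trans (filter-accept (_≟ᴮ f q) refl) (cong (f q ∷_) (filter-≟-map-injective f-inj q xs))
    ... | no x≢q   = trans (filter-reject (_≟ᴮ f q) (x≢q ∘ f-inj)) (filter-≟-map-injective f-inj q xs)

  module _ {B : Set} (_≟ᴮ_ : DecidableEquality B) {f : A → B} where

    filter-≟-map-∉ : ∀ q → (∀ x → f x ≢ q) → ∀ xs → filter (_≟ᴮ q) (map f xs) ≡ []
    filter-≟-map-∉ q f≢q xs = filter-none (_≟ᴮ q) (map⁺ (All.universal f≢q xs))

data BoundedPartition : ℕ → List ℕ → Set where
  []   : ∀ {b} → BoundedPartition b []
  cons : ∀ {b x xs} → 0 < x → x ≤ b → BoundedPartition x xs → BoundedPartition b (x ∷ xs)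

BoundedPartition⇒All≤ : ∀ {b p} → BoundedPartition b p → All (_≤ b) p
BoundedPartition⇒All≤ []              = []
BoundedPartition⇒All≤ (cons _ x≤b bp) = x≤b ∷ All.map (λ y≤x → ≤-trans y≤x x≤b) (BoundedPartition⇒All≤ bp)

partitionsBounded-sound : ∀ f n b → All (λ p → BoundedPartition b p × sum p ≡ n) (partitionsBounded f n b)
partitionsBounded-sound f       zero    b = ([] , refl) ∷ []
partitionsBounded-sound zero    (suc n) b = []
partitionsBounded-sound (suc f) (suc n) b = concat⁺ (map⁺ (applyUpTo⁺₁ (λ i → i) (b ⊓ suc n) extend))
  where
  extend : ∀ {i} → i < b ⊓ suc n →
           All (λ p → BoundedPartition b p × sum p ≡ suc n) (map (suc i ∷_) (partitionsBounded f (n ∸ i) (suc i)))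
  extend {i} i<N = map⁺ (All.map (λ (bp , sum≡) → cons z<s (≤-trans i<N (m⊓n≤m b (suc n))) bp ,
                                                   cong suc (trans (cong (i +_) sum≡) (m+[n∸m]≡n i≤n)))
                                 (partitionsBounded-sound f (n ∸ i) (suc i)))
    where
    i≤n : i ≤ n
    i≤n = ≤-pred (≤-trans i<N (m⊓n≤n b (suc n)))

_≟ₗ_ : DecidableEquality (List ℕ)
_≟ₗ_ = ≡-dec _≟_

partitionsBounded-unique : ∀ {f b q} → BoundedPartition b q → sum q ≤ f →
                           filter (_≟ₗ q) (partitionsBounded f (sum q) b) ≡ q ∷ []
partitionsBounded-unique [] _ = refl
partitionsBounded-unique {suc f} {b} {suc x ∷ q} (cons _ x<b bq) (s≤s n≤f) = begin
  filter (_≟ₗ (suc x ∷ q)) (concatMap branch (upTo (b ⊓ suc n)))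
    ≡⟨ filter-concatMap (_≟ₗ (suc x ∷ q)) branch (upTo (b ⊓ suc n)) ⟩
  concatMap (filter (_≟ₗ (suc x ∷ q)) ∘ branch) (upTo (b ⊓ suc n))
    ≡⟨ concatMap-upTo-single _ (b ⊓ suc n) (⊓-glb x<b (s≤s (m≤m+n x (sum q)))) others ⟩
  filter (_≟ₗ (suc x ∷ q)) (branch x)
    ≡⟨ filter-≟-map-injective _≟ₗ_ _≟ₗ_ ∷-injectiveʳ q (partitionsBounded f (n ∸ x) (suc x)) ⟩
  map (suc x ∷_) (filter (_≟ₗ q) (partitionsBounded f (n ∸ x) (suc x)))
    ≡⟨ cong (λ m → map (suc x ∷_) (filter (_≟ₗ q) (partitionsBounded f m (suc x)))) (m+n∸m≡n x (sum q)) ⟩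
  map (suc x ∷_) (filter (_≟ₗ q) (partitionsBounded f (sum q) (suc x)))
    ≡⟨ cong (map (suc x ∷_)) (partitionsBounded-unique bq (≤-trans (m≤n+m (sum q) x) n≤f)) ⟩
  (suc x ∷ q) ∷ [] ∎
  where
  n : ℕ
  n = x + sum q
  branch : ℕ → List (List ℕ)
  branch i = map (suc i ∷_) (partitionsBounded f (n ∸ i) (suc i))
  others : ∀ {i} → i < b ⊓ suc n → i ≢ x → filter (_≟ₗ (suc x ∷ q)) (branch i) ≡ []
  others {i} _ i≢x = filter-≟-map-∉ _≟ₗ_ (suc x ∷ q) (λ _ eq → i≢x (suc-injective (∷-injectiveˡ eq)))
                                    (partitionsBounded f (n ∸ i) (suc i))

colLength-∷-< : ∀ {r j} rs → j < r → colLength (r ∷ rs) j ≡ suc (colLength rs j)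
colLength-∷-< {r} {j} rs j<r =
  cong length (filter-accept (λ r → T? (j <ᵇ r)) {x = r} {xs = rs} (<⇒<ᵇ j<r))

colLength-∷-≥ : ∀ {r j} rs → r ≤ j → colLength (r ∷ rs) j ≡ colLength rs j
colLength-∷-≥ {r} {j} rs r≤j =
  cong length (filter-reject (λ r → T? (j <ᵇ r)) {x = r} {xs = rs} (λ j<ᵇr → <⇒≱ (<ᵇ⇒< j r j<ᵇr) r≤j))

hooksFrom-∷ : ∀ {r} rs i {rows} → All (_≤ r) rows → hooksFrom (r ∷ rs) (suc i) rows ≡ hooksFrom rs i rows
hooksFrom-∷ rs i []                       = refl
hooksFrom-∷ rs i {r′ ∷ _} (r′≤r ∷ rows≤r) = cong₂ _++_
  (map-cong-local (All.map (λ {j} j<r′ → cong (λ c → (r′ ∸ j ∸ 1) + (c ∸ suc i ∸ 1) + 1)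
                                               (colLength-∷-< rs (<-≤-trans j<r′ r′≤r)))
                           (all-upTo r′)))
  (hooksFrom-∷ rs (suc i) rows≤r)

firstRowHook : ℕ → List ℕ → ℕ → ℕ
firstRowHook r rs j = (r ∸ j ∸ 1) + colLength rs j + 1

firstRowHooks : ℕ → List ℕ → List ℕ
firstRowHooks r rs = map (firstRowHook r rs) (upTo r)

hookLengths-∷ : ∀ {r} rs → All (_≤ r) rs → hookLengths (r ∷ rs) ≡ firstRowHooks r rs ++ hookLengths rs
hookLengths-∷ {r} rs rs≤r = cong₂ _++_
  (map-cong-local (All.map (λ {j} j<r → cong (λ c → (r ∸ j ∸ 1) + (c ∸ 0 ∸ 1) + 1) (colLength-∷-< rs j<r))
                           (all-upTo r)))
  (hooksFrom-∷ rs 0 rs≤r)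

T-not-does⇔¬ : ∀ {P : Set} (P? : Dec P) → T (not (does P?)) ⇔ (¬ P)
T-not-does⇔¬ (yes p) = mk⇔ (λ ()) (λ ¬p → ¬p p)
T-not-does⇔¬ (no ¬p) = mk⇔ (λ _ → ¬p) (λ _ → _)

isCore⇔ : ∀ t λs → T (isCore t λs) ⇔ All (t ∤_) (hookLengths λs)
isCore⇔ t λs = mk⇔ (All.map (λ {h} → Equivalence.to (T-not-does⇔¬ (t ∣? h))) ∘ all⁺ _ (hookLengths λs))
                   (all⁻ _ ∘ All.map (λ {h} → Equivalence.from (T-not-does⇔¬ (t ∣? h))))

All-firstRowHooks⁻ : ∀ {P : ℕ → Set} r rs {j} → All P (firstRowHooks r rs) → j < r → P (firstRowHook r rs j)
All-firstRowHooks⁻ r rs row j<r = applyUpTo⁻ (λ j → j) r (map⁻ row) j<r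

staircase : ℕ → List ℕ
staircase zero    = []
staircase (suc m) = suc m ∷ staircase m

staircase-bounded : ∀ {m b} → m ≤ b → BoundedPartition b (staircase m)
staircase-bounded {zero}  _   = []
staircase-bounded {suc m} m<b = cons z<s m<b (staircase-bounded (n≤1+n m))

staircase-bounded⁻ : ∀ {m b} → BoundedPartition b (staircase m) → m ≤ b
staircase-bounded⁻ {zero}  _              = z≤n
staircase-bounded⁻ {suc m} (cons _ m<b _) = m<b

colLength-staircase : ∀ m j → colLength (staircase m) j ≡ m ∸ j
colLength-staircase zero    j = sym (0∸n≡0 j)
colLength-staircase (suc m) j with j <? suc m
... | yes j<1+m = begin
  colLength (suc m ∷ staircase m) j  ≡⟨ colLength-∷-< (staircase m) j<1+m ⟩
  suc (colLength (staircase m) j)    ≡⟨ cong suc (colLength-staircase m j) ⟩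
  suc (m ∸ j)                        ≡⟨ sym (+-∸-assoc 1 (≤-pred j<1+m)) ⟩
  suc m ∸ j                          ∎
... | no j≮1+m = begin
  colLength (suc m ∷ staircase m) j  ≡⟨ colLength-∷-≥ (staircase m) 1+m≤j ⟩
  colLength (staircase m) j          ≡⟨ colLength-staircase m j ⟩
  m ∸ j                              ≡⟨ m≤n⇒m∸n≡0 (≤-trans (n≤1+n m) 1+m≤j) ⟩
  0                                  ≡⟨ sym (m≤n⇒m∸n≡0 1+m≤j) ⟩
  suc m ∸ j                          ∎
  where
  1+m≤j : suc m ≤ j
  1+m≤j = ≮⇒≥ j≮1+m

firstRowHook-staircase : ∀ r m j → firstRowHook r (staircase m) j ≡ (r ∸ j ∸ 1) + (m ∸ j) + 1
firstRowHook-staircase r m j = cong (λ c → (r ∸ j ∸ 1) + c + 1) (colLength-staircase m j)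

odds : ℕ → List ℕ
odds zero    = []
odds (suc m) = 2 * m + 1 ∷ odds m

applyUpTo-odd-∸ : ∀ m → applyUpTo (λ j → 2 * (m ∸ j) + 1) (suc m) ≡ odds (suc m)
applyUpTo-odd-∸ zero    = refl
applyUpTo-odd-∸ (suc m) = cong (2 * suc m + 1 ∷_) (applyUpTo-odd-∸ m)

firstRowHooks-staircase : ∀ m → firstRowHooks (suc m) (staircase m) ≡ odds (suc m)
firstRowHooks-staircase m = begin
  map (firstRowHook (suc m) (staircase m)) (upTo (suc m))  ≡⟨ map-cong hook≡ (upTo (suc m)) ⟩
  map (λ j → 2 * (m ∸ j) + 1) (upTo (suc m))               ≡⟨ map-applyUpTo (λ j → j) _ (suc m) ⟩
  applyUpTo (λ j → 2 * (m ∸ j) + 1) (suc m)                ≡⟨ applyUpTo-odd-∸ m ⟩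
  odds (suc m)                                             ∎
  where
  hook≡ : ∀ j → firstRowHook (suc m) (staircase m) j ≡ 2 * (m ∸ j) + 1
  hook≡ j = begin
    firstRowHook (suc m) (staircase m) j  ≡⟨ firstRowHook-staircase (suc m) m j ⟩
    (suc m ∸ j ∸ 1) + (m ∸ j) + 1         ≡⟨ cong (λ x → x + (m ∸ j) + 1) 1+m∸j∸1≡m∸j ⟩
    (m ∸ j) + (m ∸ j) + 1                 ≡⟨ cong (λ x → (m ∸ j) + x + 1) (sym (+-identityʳ (m ∸ j))) ⟩
    2 * (m ∸ j) + 1                       ∎
    where
    1+m∸j∸1≡m∸j : suc m ∸ j ∸ 1 ≡ m ∸ j
    1+m∸j∸1≡m∸j = trans (∸-+-assoc (suc m) j 1) (cong (suc m ∸_) (+-comm j 1))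

hookLengths-staircase : ∀ m → hookLengths (staircase (suc m)) ≡ odds (suc m) ++ hookLengths (staircase m)
hookLengths-staircase m = trans (hookLengths-∷ (staircase m) (BoundedPartition⇒All≤ (staircase-bounded (n≤1+n m))))
                                (cong (_++ hookLengths (staircase m)) (firstRowHooks-staircase m))

odd-∤ : ∀ k → 2 ∤ 2 * k + 1
odd-∤ k 2∣2k+1 with ∣1⇒≡1 (∣m+n∣m⇒∣n 2∣2k+1 (m∣m*n k))
... | ()

staircase-core : ∀ m → All (2 ∤_) (hookLengths (staircase m))
staircase-core zero    = []
staircase-core (suc m) = subst (All (2 ∤_)) (sym (hookLengths-staircase m)) (++⁺ (odds-∤ (suc m)) (staircase-core m))
  where
  odds-∤ : ∀ n → All (2 ∤_) (odds n)
  odds-∤ zero    = []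
  odds-∤ (suc n) = odd-∤ n ∷ odds-∤ n

equal-rows-hook-two : ∀ r → 2 ∣ firstRowHook (suc r) (staircase (suc r)) r
equal-rows-hook-two r = subst (2 ∣_) (sym hook≡2) ∣-refl
  where
  hook≡2 : firstRowHook (suc r) (staircase (suc r)) r ≡ 2
  hook≡2 = trans (firstRowHook-staircase (suc r) (suc r) r) (cong (λ x → (x ∸ 1) + x + 1) (m+n∸n≡m 1 r))

long-row-hook-two : ∀ m d → 2 ∣ firstRowHook (2 + m + d) (staircase m) (m + d)
long-row-hook-two m d = subst (2 ∣_) (sym hook≡2) ∣-refl
  where
  hook≡2 : firstRowHook (2 + m + d) (staircase m) (m + d) ≡ 2
  hook≡2 = trans (firstRowHook-staircase (2 + m + d) m (m + d))
                 (cong₂ (λ x y → (x ∸ 1) + y + 1) (m+n∸n≡m 2 (m + d)) (m≤n⇒m∸n≡0 (m≤m+n m d)))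

core-row-above-staircase : ∀ {r m} → 0 < r → m ≤ r → All (2 ∤_) (firstRowHooks r (staircase m)) → r ≡ suc m
core-row-above-staircase {r} {m} 0<r m≤r row∤ with <-cmp r (suc m)
... | tri≈ _ r≡1+m _ = r≡1+m
... | tri< r<1+m _ _ with ≤-antisym m≤r (≤-pred r<1+m) | 0<r
...   | refl | s≤s _ = ⊥-elim (All-firstRowHooks⁻ r (staircase m) row∤ ≤-refl (equal-rows-hook-two (pred r)))
core-row-above-staircase {r} {m} 0<r m≤r row∤ | tri> _ _ 1+m<r with m≤n⇒∃[o]m+o≡n 1+m<r
... | d , refl =
  ⊥-elim (All-firstRowHooks⁻ _ (staircase m) row∤ (≤-trans (n<1+n (m + d)) (n≤1+n _)) (long-row-hook-two m d))

core⇒staircase : ∀ {b p} → BoundedPartition b p → All (2 ∤_) (hookLengths p) → p ≡ staircase (length p)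
core⇒staircase []                                 _    = refl
core⇒staircase (cons {x = r} {xs = rs} 0<r _ bp) core = cong₂ _∷_ r≡1+m rs≡
  where
  split : All (2 ∤_) (firstRowHooks r rs) × All (2 ∤_) (hookLengths rs)
  split = ++⁻ (firstRowHooks r rs) (subst (All (2 ∤_)) (hookLengths-∷ rs (BoundedPartition⇒All≤ bp)) core)
  rs≡ : rs ≡ staircase (length rs)
  rs≡ = core⇒staircase bp (proj₂ split)
  r≡1+m : r ≡ suc (length rs)
  r≡1+m = core-row-above-staircase 0<r (staircase-bounded⁻ (subst (BoundedPartition r) rs≡ bp))
                                       (subst (λ q → All (2 ∤_) (firstRowHooks r q)) rs≡ (proj₁ split))

≤-sum-staircase : ∀ ℓ → ℓ ≤ sum (staircase ℓ)
≤-sum-staircase zero    = z≤n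
≤-sum-staircase (suc ℓ) = m≤m+n (suc ℓ) (sum (staircase ℓ))

sum-staircase-mono-< : ∀ {m n} → m < n → sum (staircase m) < sum (staircase n)
sum-staircase-mono-< {m} {suc n} (s≤s m≤n) with m≤n⇒m<n∨m≡n m≤n
... | inj₁ m<n  = <-trans (sum-staircase-mono-< m<n) (m<n+m (sum (staircase n)) z<s)
... | inj₂ refl = m<n+m (sum (staircase n)) z<s

sum-staircase-injective : ∀ {m n} → sum (staircase m) ≡ sum (staircase n) → m ≡ n
sum-staircase-injective {m} {n} eq with <-cmp m n
... | tri< m<n _ _ = ⊥-elim (<-irrefl eq (sum-staircase-mono-< m<n))
... | tri≈ _ m≡n _ = m≡n
... | tri> _ _ n<m = ⊥-elim (<-irrefl (sym eq) (sum-staircase-mono-< n<m))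

sum-staircase-*2 : ∀ ℓ → sum (staircase ℓ) * 2 ≡ ℓ * suc ℓ
sum-staircase-*2 zero    = refl
sum-staircase-*2 (suc ℓ) = begin
  (suc ℓ + sum (staircase ℓ)) * 2  ≡⟨ *-distribʳ-+ 2 (suc ℓ) (sum (staircase ℓ)) ⟩
  suc ℓ * 2 + sum (staircase ℓ) * 2 ≡⟨ cong (suc ℓ * 2 +_) (sum-staircase-*2 ℓ) ⟩
  suc ℓ * 2 + ℓ * suc ℓ            ≡⟨ solve 1 (λ l → (con 1 :+ l) :* con 2 :+ l :* (con 1 :+ l)
                                                  := (con 1 :+ l) :* (con 2 :+ l)) refl ℓ ⟩
  suc ℓ * suc (suc ℓ)              ∎
  where open +-*-Solver

triangular≡sum-staircase : ∀ ℓ → (ℓ * suc ℓ) / 2 ≡ sum (staircase ℓ)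
triangular≡sum-staircase ℓ = trans (cong (_/ 2) (sym (sum-staircase-*2 ℓ))) (m*n/n≡m (sum (staircase ℓ)) 2)

2-core⇔staircase : ∀ {b p} ℓ → BoundedPartition b p → sum p ≡ sum (staircase ℓ) → T (isCore 2 p) ⇔ (p ≡ staircase ℓ)
2-core⇔staircase {p = p} ℓ bp sum≡ = mk⇔ to from
  where
  to : T (isCore 2 p) → p ≡ staircase ℓ
  to core = trans p≡ (cong staircase (sum-staircase-injective (trans (cong sum (sym p≡)) sum≡)))
    where
    p≡ : p ≡ staircase (length p)
    p≡ = core⇒staircase bp (Equivalence.to (isCore⇔ 2 p) core)
  from : p ≡ staircase ℓ → T (isCore 2 p)
  from refl = Equivalence.from (isCore⇔ 2 p) (staircase-core ℓ)

2-cores-of-triangular : ∀ ℓ → filterᵇ (isCore 2) (partitions (sum (staircase ℓ))) ≡ staircase ℓ ∷ []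
2-cores-of-triangular ℓ = begin
  filterᵇ (isCore 2) (partitions n)
    ≡⟨ filter-cong-local (T? ∘ isCore 2) (_≟ₗ staircase ℓ) 2-core⇔ ⟩
  filter (_≟ₗ staircase ℓ) (partitions n)
    ≡⟨ partitionsBounded-unique (staircase-bounded (≤-sum-staircase ℓ)) ≤-refl ⟩
  staircase ℓ ∷ [] ∎
  where
  n : ℕ
  n = sum (staircase ℓ)
  2-core⇔ : All (λ p → T (isCore 2 p) ⇔ (p ≡ staircase ℓ)) (partitions n)
  2-core⇔ = All.map (λ (bp , sum≡) → 2-core⇔staircase ℓ bp sum≡) (partitionsBounded-sound n n n)

multiplicity : ℕ → List ℕ → ℕ
multiplicity k xs = length (filterᵇ (λ h → h ≡ᵇ k) xs)

multiplicity-++ : ∀ k xs ys → multiplicity k (xs ++ ys) ≡ multiplicity k xs + multiplicity k ys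
multiplicity-++ k xs ys =
  trans (cong length (filter-++ (λ h → T? (h ≡ᵇ k)) xs ys)) (length-++ (filterᵇ (λ h → h ≡ᵇ k) xs))

multiplicity-∷-≡ : ∀ k xs → multiplicity k (k ∷ xs) ≡ suc (multiplicity k xs)
multiplicity-∷-≡ k xs = cong length (filter-accept (λ h → T? (h ≡ᵇ k)) {x = k} {xs = xs} (≡⇒≡ᵇ k k refl))

multiplicity-∷-≢ : ∀ {x k} xs → x ≢ k → multiplicity k (x ∷ xs) ≡ multiplicity k xs
multiplicity-∷-≢ {x} {k} xs x≢k =
  cong length (filter-reject (λ h → T? (h ≡ᵇ k)) {x = x} {xs = xs} (x≢k ∘ ≡ᵇ⇒≡ x k))

odd-injective : ∀ {j k} → 2 * j + 1 ≡ 2 * k + 1 → j ≡ k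
odd-injective {j} {k} eq = *-cancelˡ-≡ j k 2 (+-cancelʳ-≡ 1 (2 * j) (2 * k) eq)

multiplicity-odd-odds-≥ : ∀ {k m} → m ≤ k → multiplicity (2 * k + 1) (odds m) ≡ 0
multiplicity-odd-odds-≥ {k} {zero}  _     = refl
multiplicity-odd-odds-≥ {k} {suc m} 1+m≤k =
  trans (multiplicity-∷-≢ (odds m) (<⇒≢ 1+m≤k ∘ odd-injective)) (multiplicity-odd-odds-≥ (≤-trans (n≤1+n m) 1+m≤k))

multiplicity-odd-odds-< : ∀ {k m} → k < m → multiplicity (2 * k + 1) (odds m) ≡ 1
multiplicity-odd-odds-< {k} {suc m} (s≤s k≤m) with m≤n⇒m<n∨m≡n k≤m
... | inj₁ k<m  = trans (multiplicity-∷-≢ (odds m) (≢-sym (<⇒≢ k<m) ∘ odd-injective)) (multiplicity-odd-odds-< k<m)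
... | inj₂ refl = trans (multiplicity-∷-≡ (2 * k + 1) (odds k)) (cong suc (multiplicity-odd-odds-≥ {k} ≤-refl))

numHooks-odd-staircase : ∀ k ℓ → numHooks (2 * k + 1) (staircase ℓ) ≡ ℓ ∸ k
numHooks-odd-staircase k zero    = sym (0∸n≡0 k)
numHooks-odd-staircase k (suc m) = begin
  multiplicity (2 * k + 1) (hookLengths (staircase (suc m)))
    ≡⟨ cong (multiplicity (2 * k + 1)) (hookLengths-staircase m) ⟩
  multiplicity (2 * k + 1) (odds (suc m) ++ hookLengths (staircase m))
    ≡⟨ multiplicity-++ (2 * k + 1) (odds (suc m)) (hookLengths (staircase m)) ⟩
  multiplicity (2 * k + 1) (odds (suc m)) + numHooks (2 * k + 1) (staircase m)
    ≡⟨ cong (multiplicity (2 * k + 1) (odds (suc m)) +_) (numHooks-odd-staircase k m) ⟩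
  multiplicity (2 * k + 1) (odds (suc m)) + (m ∸ k)
    ≡⟨ newRow (k ≤? m) ⟩
  suc m ∸ k ∎
  where
  newRow : Dec (k ≤ m) → multiplicity (2 * k + 1) (odds (suc m)) + (m ∸ k) ≡ suc m ∸ k
  newRow (yes k≤m) = trans (cong (_+ (m ∸ k)) (multiplicity-odd-odds-< (s≤s k≤m))) (sym (+-∸-assoc 1 k≤m))
  newRow (no k≰m)  = begin
    multiplicity (2 * k + 1) (odds (suc m)) + (m ∸ k)
      ≡⟨ cong₂ _+_ (multiplicity-odd-odds-≥ 1+m≤k) (m≤n⇒m∸n≡0 (≤-trans (n≤1+n m) 1+m≤k)) ⟩
    0
      ≡⟨ sym (m≤n⇒m∸n≡0 1+m≤k) ⟩
    suc m ∸ k ∎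
    where
    1+m≤k : suc m ≤ k
    1+m≤k = ≰⇒> k≰m

a-2-triangular : ∀ v ℓ → a 2 v ((ℓ * suc ℓ) / 2) ≡ numHooks v (staircase ℓ)
a-2-triangular v ℓ = begin
  a 2 v ((ℓ * suc ℓ) / 2)         ≡⟨ cong (a 2 v) (triangular≡sum-staircase ℓ) ⟩
  a 2 v (sum (staircase ℓ))       ≡⟨ cong (sum ∘ map (numHooks v)) (2-cores-of-triangular ℓ) ⟩
  numHooks v (staircase ℓ) + 0    ≡⟨ +-identityʳ _ ⟩
  numHooks v (staircase ℓ)        ∎

m∸n≡1+[m∸1+n] : ∀ {m n} → n < m → m ∸ n ≡ suc (m ∸ suc n)
m∸n≡1+[m∸1+n] {suc m} (s≤s n≤m) = +-∸-assoc 1 n≤m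

corollary1p2 : (ℓ k : ℕ) → k + 2 ≤ ℓ →
    a 2 (2 * k + 1) ((ℓ * suc ℓ) / 2) ≡ 1 + a 2 (2 * k + 3) ((ℓ * suc ℓ) / 2)
corollary1p2 ℓ k k+2≤ℓ = begin
  a 2 (2 * k + 1) ((ℓ * suc ℓ) / 2)          ≡⟨ a-2-triangular (2 * k + 1) ℓ ⟩
  numHooks (2 * k + 1) (staircase ℓ)         ≡⟨ numHooks-odd-staircase k ℓ ⟩
  ℓ ∸ k                                      ≡⟨ m∸n≡1+[m∸1+n] (<-≤-trans (m<m+n k z<s) k+2≤ℓ) ⟩
  1 + (ℓ ∸ suc k)                            ≡⟨ cong suc (sym (numHooks-odd-staircase (suc k) ℓ)) ⟩
  1 + numHooks (2 * suc k + 1) (staircase ℓ) ≡⟨ cong (λ v → 1 + numHooks v (staircase ℓ)) 2[1+k]+1≡2k+3 ⟩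
  1 + numHooks (2 * k + 3) (staircase ℓ)     ≡⟨ cong suc (sym (a-2-triangular (2 * k + 3) ℓ)) ⟩
  1 + a 2 (2 * k + 3) ((ℓ * suc ℓ) / 2)      ∎
  where
  2[1+k]+1≡2k+3 : 2 * suc k + 1 ≡ 2 * k + 3
  2[1+k]+1≡2k+3 = trans (cong (_+ 1) (*-suc 2 k)) (trans (cong (_+ 1) (+-comm 2 (2 * k))) (+-assoc (2 * k) 2 1))
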